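{- Let $g$ be a positive integer and $S$ a numerical semigroup of genus $g$. The number of children $S'$ of $S$ in the ordinarization tree $\mathcal{T}_g$ with $h(S')=0$ is at most $\left\lfloor\frac{m(S)}{2}\right\rfloor$.
   Context: For a numerical semigroup $S$ (additive submonoid of $\mathbb{N}_0$ with finite complement), $F(S)$ is the largest gap, $m(S)$ the smallest nonzero element, and the genus is the number of gaps. $S_g=\{0,g+1,g+2,\ldots\}$. A numerical semigroup $S'\neq S_g$ of genus $g$ is a child of $S$ in $\mathcal{T}_g$ if $S'\cup\{F(S')\}\setminus\{m(S')\}=S$. The effective generators of $S$ are its minimal generators larger than $F(S)$, and $h(S)$ is their number. -}

module Defs where

open import Data.Nat using (ℕ; zero; suc; _+_; _≤_; _<_; _≡ᵇ_; _≤?_)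
open import Data.Nat.Properties using ()
open import Data.Bool using (Bool; true; false; _∨_; _∧_; not)
open import Data.List using (List; filter; length; upTo)
open import Data.Product using (Σ; ∃; ∃-syntax; _×_; _,_)
open import Relation.Nullary using (¬_)
open import Relation.Binary.PropositionalEquality using (_≡_; _≢_)
open import Relation.Nullary.Decidable using (does)
open import Data.Bool.Properties using (_≟_)

record NumericalSemigroup : Set where
  field
    mem      : ℕ → Bool
    zero∈    : mem 0 ≡ true
    closed   : ∀ a b → mem a ≡ true → mem b ≡ true → mem (a + b) ≡ true
    cofinite : ∃[ N ] (∀ n → N ≤ n → mem n ≡ true)
open NumericalSemigroup public

_≢ₛ_ : NumericalSemigroup → NumericalSemigroup → Set
S ≢ₛ T = ∃[ n ] (mem S n ≢ mem T n)

gapsBelow : NumericalSemigroup → ℕ → List ℕ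
gapsBelow S N = filter (λ n → mem S n ≟ false) (upTo N)

HasGenus : NumericalSemigroup → ℕ → Set
HasGenus S g = ∃[ N ] ((∀ n → N ≤ n → mem S n ≡ true) × length (gapsBelow S N) ≡ g)

-- The ordinary semigroup S_g = {0, g+1, g+2, ...}
ordMem : ℕ → ℕ → Bool
ordMem g zero = true
ordMem g (suc n) = does (g ≤? n)

IsFrobenius : NumericalSemigroup → ℕ → Set
IsFrobenius S f = mem S f ≡ false × (∀ n → f < n → mem S n ≡ true)

IsMultiplicity : NumericalSemigroup → ℕ → Set
IsMultiplicity S m = 0 < m × mem S m ≡ true × (∀ k → 0 < k → k < m → mem S k ≡ false)

IsChild : ℕ → NumericalSemigroup → NumericalSemigroup → Set
IsChild g S S' =
  HasGenus S' g ×
  (∃[ n ] (mem S' n ≢ ordMem g n)) ×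
  (∃[ f ] ∃[ m ] (IsFrobenius S' f × IsMultiplicity S' m ×
     (∀ n → mem S n ≡ ((mem S' n ∨ (n ≡ᵇ f)) ∧ not (n ≡ᵇ m)))))

IsMinimalGenerator : NumericalSemigroup → ℕ → Set
IsMinimalGenerator S x =
  0 < x × mem S x ≡ true ×
  ¬ (∃[ a ] ∃[ b ] (0 < a × 0 < b × mem S a ≡ true × mem S b ≡ true × a + b ≡ x))

-- x is an effective generator of S: a minimal generator larger than F(S)
-- (for S = ℕ there is no Frobenius number and the condition is vacuous, F(ℕ) = -1).
IsEffectiveGenerator : NumericalSemigroup → ℕ → Set
IsEffectiveGenerator S x = IsMinimalGenerator S x × (∀ f → IsFrobenius S f → f < x)

HZero : NumericalSemigroup → Set
HZero S = ∀ x → ¬ IsEffectiveGenerator S x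

-- Let S′ be a child of S with h(S′) = 0, of multiplicity p and Frobenius
-- number f, so that S = S′ ∪ {f} ∖ {p}. Since p is a minimal generator of S′
-- and not effective, p < f; hence m(S) is an element of S′ other than p, and
-- 2p ∈ S, giving m(S)/2 ≤ p < m(S). Two such children S₁, S₂ with the same p
-- coincide: both agree with S outside p and their Frobenius numbers, so if
-- f₁ < f₂ then every element of S₁ below f₂ lies in S₂, which makes f₂ an
-- effective generator of S₁. So the children are counted by distinct
-- integers in [m(S) − ⌊m(S)/2⌋, m(S)).
module Submission where

open import Defs
open import Data.Nat using (ℕ; _<_; _≤_; _/_)
open import Data.List using (List; length)
open import Data.List.Relation.Unary.All using (All)
open import Data.List.Relation.Unary.AllPairs using (AllPairs)
open import Data.Product using (_×_)

open import Data.Bool using (true; false; _∨_; _∧_; not)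
open import Data.Bool.Properties using (∨-identityʳ; ∧-identityʳ; ∧-zeroʳ)
open import Data.List using ([]; _∷_; filter)
open import Data.List.Properties using (filter-all; filter-accept; filter-reject)
open import Data.List.Relation.Unary.All using ([]; _∷_; reduce; universal-U)
import Data.List.Relation.Unary.All as All
open import Data.List.Relation.Unary.All.Properties using (all-filter; filter⁺)
open import Data.List.Relation.Unary.AllPairs using ([]; _∷_)
import Data.List.Relation.Unary.AllPairs.Properties as AllPairs
open import Data.Nat using (zero; suc; _+_; _∸_; _≡ᵇ_; z≤n; s≤s)
open import Data.Nat.DivMod using (m/n≡1+[m∸n]/n; m/n≤m)
open import Data.Nat.Properties
open import Data.Product using (_,_; proj₁; proj₂)
open import Function using (_∘_)
open import Relation.Binary using (tri<; tri≈; tri>)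
open import Relation.Binary.PropositionalEquality
open import Relation.Nullary using (¬_; ¬?; Dec; yes; no; contradiction)
open import Relation.Nullary.Decidable using (dec-true; dec-false)

module _ {S : NumericalSemigroup} where

  member≢gap : ∀ {x y} → mem S x ≡ true → mem S y ≡ false → x ≢ y
  member≢gap x∈S y∉S refl = contradiction (trans (sym x∈S) y∉S) λ ()

  multiplicity≤ : ∀ {p a} → IsMultiplicity S p → 0 < a → mem S a ≡ true → p ≤ a
  multiplicity≤ (_ , _ , below-p∉S) a>0 a∈S =
    ≮⇒≥ λ a<p → member≢gap a∈S (below-p∉S _ a>0 a<p) refl

  gap≤frobenius : ∀ {f n} → IsFrobenius S f → mem S n ≡ false → n ≤ f
  gap≤frobenius (_ , above-f∈S) n∉S = ≮⇒≥ λ f<n → member≢gap (above-f∈S _ f<n) n∉S refl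

  frobenius-unique : ∀ {f f′} → IsFrobenius S f → IsFrobenius S f′ → f ≡ f′
  frobenius-unique isF isF′ =
    ≤-antisym (gap≤frobenius isF′ (proj₁ isF)) (gap≤frobenius isF (proj₁ isF′))

  minimalGenerator⇒effective : ∀ {f x} → IsFrobenius S f → f < x →
                               IsMinimalGenerator S x → IsEffectiveGenerator S x
  minimalGenerator⇒effective isF f<x minimal =
    minimal , λ f′ isF′ → subst (_< _) (frobenius-unique isF isF′) f<x

  multiplicity-minimalGenerator : ∀ {p} → IsMultiplicity S p → IsMinimalGenerator S p
  multiplicity-minimalGenerator isM@(p>0 , p∈S , _) =
    p>0 , p∈S , λ { (a , b , a>0 , b>0 , a∈S , _ , refl) →
      <⇒≱ (m<m+n a b>0) (multiplicity≤ isM a>0 a∈S) }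

  multiplicity<frobenius : ∀ {p f} → HZero S → IsMultiplicity S p → IsFrobenius S f → p < f
  multiplicity<frobenius hZero isM isF with <-cmp _ _
  ... | tri< p<f _ _ = p<f
  ... | tri≈ _ p≡f _ = contradiction p≡f (member≢gap (proj₁ (proj₂ isM)) (proj₁ isF))
  ... | tri> _ _ f<p =
    contradiction (minimalGenerator⇒effective isF f<p (multiplicity-minimalGenerator isM)) (hZero _)

record OrdinarizationStep (S′ S : NumericalSemigroup) (p f : ℕ) : Set where
  field
    isMultiplicity : IsMultiplicity S′ p
    isFrobenius    : IsFrobenius S′ f
    parent         : ∀ n → mem S n ≡ ((mem S′ n ∨ (n ≡ᵇ f)) ∧ not (n ≡ᵇ p))

  multiplicity∈ : mem S′ p ≡ true
  multiplicity∈ = proj₁ (proj₂ isMultiplicity)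

  frobenius∉ : mem S′ f ≡ false
  frobenius∉ = proj₁ isFrobenius

  -- does (n ≟ k) computes to n ≡ᵇ k, so dec-true/dec-false evaluate the tests in parent.
  multiplicity∉parent : mem S p ≡ false
  multiplicity∉parent = begin
    mem S p                                       ≡⟨ parent p ⟩
    (mem S′ p ∨ (p ≡ᵇ f)) ∧ not (p ≡ᵇ p)          ≡⟨ cong (λ b → (mem S′ p ∨ (p ≡ᵇ f)) ∧ not b) (dec-true (p ≟ p) refl) ⟩
    (mem S′ p ∨ (p ≡ᵇ f)) ∧ false                 ≡⟨ ∧-zeroʳ _ ⟩
    false                                         ∎
    where open ≡-Reasoning

  parent-mem : ∀ {n} → n ≢ p → n ≢ f → mem S n ≡ mem S′ n
  parent-mem {n} n≢p n≢f = begin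
    mem S n                                       ≡⟨ parent n ⟩
    (mem S′ n ∨ (n ≡ᵇ f)) ∧ not (n ≡ᵇ p)          ≡⟨ cong₂ (λ b c → (mem S′ n ∨ b) ∧ not c) (dec-false (n ≟ f) n≢f) (dec-false (n ≟ p) n≢p) ⟩
    (mem S′ n ∨ false) ∧ true                     ≡⟨ ∧-identityʳ _ ⟩
    mem S′ n ∨ false                              ≡⟨ ∨-identityʳ _ ⟩
    mem S′ n                                      ∎
    where open ≡-Reasoning

  module _ (hZero : HZero S′) {m : ℕ} (isMₛ : IsMultiplicity S m) where

    p<parentMultiplicity : p < m
    p<parentMultiplicity with m ≟ f | m ≟ p
    ... | yes refl | _       = multiplicity<frobenius {S′} hZero isMultiplicity isFrobenius
    ... | no _     | yes refl = contradiction refl (member≢gap {S} (proj₁ (proj₂ isMₛ)) multiplicity∉parent)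
    ... | no m≢f   | no m≢p  =
      ≤∧≢⇒< (multiplicity≤ {S′} isMultiplicity (proj₁ isMₛ) (trans (sym (parent-mem m≢p m≢f)) (proj₁ (proj₂ isMₛ)))) (m≢p ∘ sym)

  parentMultiplicity≤p+p : ∀ {m} → IsMultiplicity S m → m ≤ p + p
  parentMultiplicity≤p+p isMₛ =
    multiplicity≤ {S} isMₛ (<-≤-trans p>0 (m≤m+n p p)) (trans (parent-mem 2p≢p 2p≢f) 2p∈S′)
    where
      p>0 : 0 < p
      p>0 = proj₁ isMultiplicity
      2p∈S′ : mem S′ (p + p) ≡ true
      2p∈S′ = closed S′ p p multiplicity∈ multiplicity∈
      2p≢p : p + p ≢ p
      2p≢p = >⇒≢ (m<m+n p p>0)
      2p≢f : p + p ≢ f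
      2p≢f = member≢gap {S′} 2p∈S′ frobenius∉

module Siblings {S S₁ S₂ : NumericalSemigroup} {p f₁ f₂ : ℕ}
                (step₁ : OrdinarizationStep S₁ S p f₁) (step₂ : OrdinarizationStep S₂ S p f₂) where

  private
    module step₁ = OrdinarizationStep step₁
    module step₂ = OrdinarizationStep step₂

  mem-below-frobenius : ∀ {x} → mem S₁ x ≡ true → x < f₂ → mem S₂ x ≡ true
  mem-below-frobenius {x} x∈S₁ x<f₂ with x ≟ p
  ... | yes refl = step₂.multiplicity∈
  ... | no x≢p   = begin
    mem S₂ x  ≡⟨ step₂.parent-mem x≢p (<⇒≢ x<f₂) ⟨
    mem S x   ≡⟨ step₁.parent-mem x≢p (member≢gap {S₁} x∈S₁ step₁.frobenius∉) ⟩
    mem S₁ x  ≡⟨ x∈S₁ ⟩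
    true      ∎
    where open ≡-Reasoning

  frobenius≮ : HZero S₁ → ¬ f₁ < f₂
  frobenius≮ hZero f₁<f₂ = hZero f₂ (minimalGenerator⇒effective {S₁} step₁.isFrobenius f₁<f₂ minimal)
    where
      minimal : IsMinimalGenerator S₁ f₂
      minimal = ≤-<-trans z≤n f₁<f₂ , proj₂ step₁.isFrobenius f₂ f₁<f₂ ,
        λ { (a , b , a>0 , b>0 , a∈S₁ , b∈S₁ , refl) →
          member≢gap {S₂}
            (closed S₂ a b (mem-below-frobenius a∈S₁ (m<m+n a b>0)) (mem-below-frobenius b∈S₁ (m<n+m b a>0)))
            step₂.frobenius∉ refl }

module _ {S S₁ S₂ : NumericalSemigroup} {p f : ℕ}
         (step₁ : OrdinarizationStep S₁ S p f) (step₂ : OrdinarizationStep S₂ S p f) where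

  private
    module step₁ = OrdinarizationStep step₁
    module step₂ = OrdinarizationStep step₂

  sameStep-mem : ∀ n → mem S₁ n ≡ mem S₂ n
  sameStep-mem n with n ≟ p | n ≟ f
  ... | yes refl | _        = trans step₁.multiplicity∈ (sym step₂.multiplicity∈)
  ... | no _     | yes refl = trans step₁.frobenius∉ (sym step₂.frobenius∉)
  ... | no n≢p   | no n≢f   = trans (sym (step₁.parent-mem n≢p n≢f)) (step₂.parent-mem n≢p n≢f)

siblings-mem : ∀ {S S₁ S₂ p f₁ f₂} → OrdinarizationStep S₁ S p f₁ → OrdinarizationStep S₂ S p f₂ →
               HZero S₁ → HZero S₂ → ∀ n → mem S₁ n ≡ mem S₂ n
siblings-mem step₁ step₂ hZero₁ hZero₂
  with refl ← ≤-antisym (≮⇒≥ (Siblings.frobenius≮ step₂ step₁ hZero₂))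
                        (≮⇒≥ (Siblings.frobenius≮ step₁ step₂ hZero₁))
  = sameStep-mem step₁ step₂

_≢?_ : (x k : ℕ) → Dec (x ≢ k)
x ≢? k = ¬? (x ≟ k)

_without_ : List ℕ → ℕ → List ℕ
xs without k = filter (_≢? k) xs

length≤1+length-without : ∀ {xs} k → AllPairs _≢_ xs → length xs ≤ suc (length (xs without k))
length≤1+length-without {[]}     k []                   = z≤n
length≤1+length-without {x ∷ xs} k (x∉xs ∷ distinct) with x ≟ k
... | yes refl = ≤-reflexive (cong (suc ∘ length) (begin
  xs                   ≡⟨ filter-all (_≢? x) (All.map ≢-sym x∉xs) ⟨
  xs without x         ≡⟨ filter-reject (_≢? x) (λ x≢x → x≢x refl) ⟨
  (x ∷ xs) without x   ∎))
  where open ≡-Reasoning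
... | no x≢k   = begin
  suc (length xs)                  ≤⟨ s≤s (length≤1+length-without k distinct) ⟩
  suc (length (x ∷ xs without k))  ≡⟨ cong (suc ∘ length) (filter-accept (_≢? k) x≢k) ⟨
  suc (length ((x ∷ xs) without k)) ∎
  where open ≤-Reasoning

length-distinct-between : ∀ {lo} hi {xs} → AllPairs _≢_ xs → All (λ x → lo ≤ x × x < hi) xs →
                          length xs ≤ hi ∸ lo
length-distinct-between hi       {[]}     _        _                    = z≤n
length-distinct-between zero     {_ ∷ _}  _        ((_ , ()) ∷ _)
length-distinct-between {lo} (suc h) {xs@(_ ∷ _)} distinct between@((lo≤x , x<1+h) ∷ _) = begin
  length xs                    ≤⟨ length≤1+length-without h distinct ⟩
  suc (length (xs without h))  ≤⟨ s≤s (length-distinct-between h (AllPairs.filter⁺ (_≢? h) distinct) between′) ⟩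
  suc (h ∸ lo)                 ≡⟨ +-∸-assoc 1 (≤-trans lo≤x (≤-pred x<1+h)) ⟨
  suc h ∸ lo                   ∎
  where
    open ≤-Reasoning
    below-h : ∀ {x} → x < suc h → x ≢ h → x < h
    below-h x<1+h x≢h = ≤∧≢⇒< (≤-pred x<1+h) x≢h
    between′ : All (λ x → lo ≤ x × x < h) (xs without h)
    between′ = All.zipWith (λ { ((lo≤x , x<1+h) , x≢h) → lo≤x , below-h x<1+h x≢h })
                           (filter⁺ (_≢? h) between , all-filter (_≢? h) xs)

m≤n+n⇒m∸m/2≤n : ∀ m n → m ≤ n + n → m ∸ m / 2 ≤ n
m≤n+n⇒m∸m/2≤n zero          n       _  = z≤n
m≤n+n⇒m∸m/2≤n (suc zero)    (suc n) _  = s≤s z≤n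
m≤n+n⇒m∸m/2≤n (suc (suc m)) (suc n) 2+m≤2+2n = begin
  suc (suc m) ∸ suc (suc m) / 2  ≡⟨ cong (suc (suc m) ∸_) (m/n≡1+[m∸n]/n {suc (suc m)} {2} (s≤s (s≤s z≤n))) ⟩
  suc m ∸ m / 2                  ≡⟨ +-∸-assoc 1 (m/n≤m m 2) ⟩
  suc (m ∸ m / 2)                ≤⟨ s≤s (m≤n+n⇒m∸m/2≤n m n m≤2n) ⟩
  suc n                          ∎
  where
    open ≤-Reasoning
    m≤2n : m ≤ n + n
    m≤2n = ≤-pred (≤-pred (≤-trans 2+m≤2+2n (≤-reflexive (cong suc (+-suc n n)))))

module _ {A B : Set} {P : A → Set} (f : ∀ {x} → P x → B) where

  length-reduce : ∀ {xs} (pxs : All P xs) → length (reduce f pxs) ≡ length xs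
  length-reduce []         = refl
  length-reduce (px ∷ pxs) = cong suc (length-reduce pxs)

  reduce⁺ : ∀ {Q : A → Set} {Q′ : B → Set} → (∀ {x} (px : P x) → Q x → Q′ (f px)) →
            ∀ {xs} → All Q xs → (pxs : All P xs) → All Q′ (reduce f pxs)
  reduce⁺ q⇒q′ []         []         = []
  reduce⁺ q⇒q′ (qx ∷ qxs) (px ∷ pxs) = q⇒q′ px qx ∷ reduce⁺ q⇒q′ qxs pxs

  AllPairs-reduce⁺ : ∀ {R : A → A → Set} {R′ : B → B → Set} →
                     (∀ {x y} (px : P x) (py : P y) → R x y → R′ (f px) (f py)) →
                     ∀ {xs} → AllPairs R xs → (pxs : All P xs) → AllPairs R′ (reduce f pxs)
  AllPairs-reduce⁺ r⇒r′ []             []         = []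
  AllPairs-reduce⁺ r⇒r′ (rxs ∷ distinct) (px ∷ pxs) =
    reduce⁺ (r⇒r′ px) rxs pxs ∷ AllPairs-reduce⁺ r⇒r′ distinct pxs

record HZeroChild (S S′ : NumericalSemigroup) : Set where
  field
    multiplicity frobenius : ℕ
    step                   : OrdinarizationStep S′ S multiplicity frobenius
    hZero                  : HZero S′

  open OrdinarizationStep step public

isChild⇒HZeroChild : ∀ {g S S′} → IsChild g S S′ × HZero S′ → HZeroChild S S′
isChild⇒HZeroChild ((_ , _ , f , p , isF , isM , parent) , hZero) = record
  { multiplicity = p
  ; frobenius    = f
  ; step         = record { isMultiplicity = isM ; isFrobenius = isF ; parent = parent }
  ; hZero        = hZero
  }

module _ {S : NumericalSemigroup} where

  open HZeroChild

  multiplicity-between : ∀ {m S′} → IsMultiplicity S m → (child : HZeroChild S S′) →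
                         m ∸ m / 2 ≤ multiplicity child × multiplicity child < m
  multiplicity-between {m} isMₛ child =
    m≤n+n⇒m∸m/2≤n m _ (parentMultiplicity≤p+p child isMₛ) , p<parentMultiplicity child (hZero child) isMₛ

  multiplicity-injective : ∀ {S₁ S₂} (child₁ : HZeroChild S S₁) (child₂ : HZeroChild S S₂) →
                           S₁ ≢ₛ S₂ → multiplicity child₁ ≢ multiplicity child₂
  multiplicity-injective {S₂ = S₂} child₁ child₂ (n , differ) p₁≡p₂ =
    differ (siblings-mem (step child₁) step₂ (hZero child₁) (hZero child₂) n)
    where
      step₂ : OrdinarizationStep S₂ S (multiplicity child₁) (frobenius child₂)
      step₂ = subst (λ p → OrdinarizationStep S₂ S p _) (sym p₁≡p₂) (step child₂)

mainTheorem9 : (g : ℕ) → 0 < g → (S : NumericalSemigroup) → HasGenus S g →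
    (m : ℕ) → IsMultiplicity S m →
    (L : List NumericalSemigroup) →
    All (λ S' → IsChild g S S' × HZero S') L →
    AllPairs _≢ₛ_ L →
    length L ≤ m / 2
mainTheorem9 g _ S _ m isM L children distinct = begin
  length L                  ≡⟨ length-reduce multiplicity hZeroChildren ⟨
  length multiplicities     ≤⟨ length-distinct-between m
                                 (AllPairs-reduce⁺ multiplicity multiplicity-injective distinct hZeroChildren)
                                 (reduce⁺ multiplicity (λ child _ → multiplicity-between isM child)
                                    (universal-U L) hZeroChildren) ⟩
  m ∸ (m ∸ m / 2)           ≡⟨ m∸[m∸n]≡n (m/n≤m m 2) ⟩
  m / 2                     ∎
  where
    open ≤-Reasoning
    open HZeroChild using (multiplicity)
    hZeroChildren : All (HZeroChild S) L
    hZeroChildren = All.map isChild⇒HZeroChild children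
    multiplicities : List ℕ
    multiplicities = reduce multiplicity hZeroChildren
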